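{- Let $G=(V,E)$ be a connected graph with $vol(G)\ge11$. Suppose there exists a subset $A\subset V$ with $cut(A,V\setminus A)=2$ and $|vol(A)-vol(G)/2|\le3$. If there exists no subset $B\subset V$ with $cut(B,V\setminus B)=1$ and $|vol(B)-vol(G)/2|\le\frac{\sqrt{36+vol(G)^2}}{2\sqrt2}$, then $Mcut(G)=Mcut_2(G)$.
   Context: For a graph with vertex degrees $d_v$: $vol(S)=\sum_{v\in S}d_v$, $vol(G)=vol(V)$; $cut(S,T)$ is the number of edges between disjoint $S,T$; $Ncut(S,T)=cut(S,T)(1/vol(S)+1/vol(T))$; $Mcut_j(G)=\min\{Ncut(C,V\setminus C):\emptyset\ne C\subsetneq V,\ cut(C,V\setminus C)=j\}$ (convention $\min\emptyset=+\infty$); $Mcut(G)=\min_{j\ge1}Mcut_j(G)$. -}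

module Defs where

open import Data.Bool using (Bool; true; false; not; _∧_)
open import Data.Nat as ℕ using (ℕ; zero; suc)
open import Data.Integer using (+_)
open import Data.Fin using (Fin; zero; suc)
open import Data.List using (List; []; _∷_; map; foldr; filterᵇ; allFin; concatMap; upTo)
open import Data.Nat.ListAction using (sum)
open import Data.Bool.ListAction using (any)
open import Data.Maybe using (Maybe; just; nothing)
open import Data.Rational as ℚ using (ℚ; _/_; 1/_; 0ℚ)
open import Relation.Binary.PropositionalEquality using (_≡_)
open import Relation.Nullary.Decidable using (⌊_⌋)

record Graph (n : ℕ) : Set where
  field
    adj     : Fin n → Fin n → Bool
    symm    : ∀ u v → adj u v ≡ adj v u
    irrefl  : ∀ v → adj v v ≡ false
open Graph public

VSubset : ℕ → Set
VSubset n = Fin n → Bool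

Σv : ∀ {n} → (Fin n → ℕ) → ℕ
Σv {n} f = sum (map f (allFin n))

b2n : Bool → ℕ
b2n true  = 1
b2n false = 0

deg : ∀ {n} → Graph n → Fin n → ℕ
deg G v = Σv (λ u → b2n (adj G v u))

vol : ∀ {n} → Graph n → VSubset n → ℕ
vol G S = Σv (λ v → b2n (S v) ℕ.* deg G v)

volG : ∀ {n} → Graph n → ℕ
volG G = vol G (λ _ → true)

compl : ∀ {n} → VSubset n → VSubset n
compl S v = not (S v)

-- cut(S, V \ S): number of edges with one end in S and the other outside S
-- (each edge counted once via the ordered pair (u ∈ S, w ∉ S)).
cutC : ∀ {n} → Graph n → VSubset n → ℕ
cutC G S = Σv (λ u → Σv (λ w → b2n (adj G u w ∧ S u ∧ not (S w))))

ℕ→ℚ : ℕ → ℚ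
ℕ→ℚ k = + k / 1

-- 1/k (only ever used with k > 0; the value at 0 is an irrelevant junk value)
inv : ℕ → ℚ
inv zero    = 0ℚ
inv (suc k) = + 1 / suc k

Ncut : ∀ {n} → Graph n → VSubset n → ℚ
Ncut G S = ℕ→ℚ (cutC G S) ℚ.* (inv (vol G S) ℚ.+ inv (vol G (compl S)))

consS : ∀ {n} → Bool → VSubset n → VSubset (suc n)
consS b S zero    = b
consS b S (suc i) = S i

allSubsets : ∀ n → List (VSubset n)
allSubsets zero    = (λ ()) ∷ []
allSubsets (suc n) = concatMap (λ S → consS false S ∷ consS true S ∷ []) (allSubsets n)

nonemptyProper : ∀ {n} → VSubset n → Bool
nonemptyProper {n} C = any C (allFin n) ∧ any (λ v → not (C v)) (allFin n)

-- ℚ ∪ {+∞}: nothing = +∞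
ℚ∞ : Set
ℚ∞ = Maybe ℚ

min∞ : ℚ∞ → ℚ∞ → ℚ∞
min∞ nothing  y        = y
min∞ (just x) nothing  = just x
min∞ (just x) (just y) = just (x ℚ.⊓ y)

McutJ : ∀ {n} → ℕ → Graph n → ℚ∞
McutJ {n} j G =
  foldr min∞ nothing
    (map (λ C → just (Ncut G C))
      (filterᵇ (λ C → nonemptyProper C ∧ (cutC G C ℕ.≡ᵇ j)) (allSubsets n)))

-- Mcut(G) = min_{j ≥ 1} McutJj(G).  Since cut(C,V\C) ≤ vol(C) ≤ vol(G), McutJj(G) = +∞
-- for every j > vol(G), so it suffices to take the minimum over 1 ≤ j ≤ vol(G).
Mcut : ∀ {n} → Graph n → ℚ∞
Mcut G = foldr min∞ nothing (map (λ i → McutJ (suc i) G) (upTo (volG G)))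

data Reach {n} (G : Graph n) : Fin n → Fin n → Set where
  here : ∀ {v} → Reach G v v
  step : ∀ {u w v} → adj G u w ≡ true → Reach G w v → Reach G u v

Connected : ∀ {n} → Graph n → Set
Connected {n} G = ∀ (u v : Fin n) → Reach G u v

module Submission where

-- Write V = vol(G) and, for a vertex set S with complement S', s = vol(S), s' = vol(S').
-- Since s + s' = V, the product identity  4 s s' + (2s − V)² = V²  holds, and a cut
-- with j edges has Ncut = j V / (s s').  Let A be the given set (cut 2, |2a − V| ≤ 6)
-- and C any set with cut j ∉ {0, 2}.  Then Ncut(A) ≤ Ncut(C) reduces to 2 c c' ≤ j a a':
--   * j = 1: the hypothesis says 2 (2c − V)² > 36 + V², hence 8 c c' < V² − 36 ≤ 4 a a';
--   * j ≥ 3: 8 c c' ≤ 2 V² ≤ 3 V² − 108 ≤ 12 a a', using V² ≥ 121.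
-- Hence Ncut(A) bounds every level Mcut_j from below, while A itself lies on level 2,
-- so Mcut_2(G) is the least level and Mcut(G) = Mcut_2(G).

open import Defs
open import Data.Nat using (ℕ; _≤_)
open import Data.Integer using (+_)
open import Data.Product using (Σ; _×_)
open import Relation.Binary.PropositionalEquality using (_≡_)
open import Relation.Nullary using (¬_)

module ListSums where

  open import Data.Nat using (_+_; _*_; z≤n)
  open import Data.Nat.Properties using (+-mono-≤; *-zeroʳ; *-distribˡ-+)
  open import Data.Nat.Tactic.RingSolver using (solve-∀)
  open import Data.List using (List; []; _∷_; map)
  open import Data.Nat.ListAction using (sum)
  open import Relation.Binary.PropositionalEquality using (refl; sym; cong₂)

  private
    interchange : ∀ a b c d → (a + b) + (c + d) ≡ (a + c) + (b + d)
    interchange = solve-∀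

  sum-+ : ∀ {A : Set} (f g : A → ℕ) (xs : List A) →
    sum (map (λ x → f x + g x) xs) ≡ sum (map f xs) + sum (map g xs)
  sum-+ f g []       = refl
  sum-+ f g (x ∷ xs) rewrite sum-+ f g xs = interchange (f x) (g x) _ _

  sum-cong : ∀ {A : Set} {f g : A → ℕ} (xs : List A) → (∀ x → f x ≡ g x) →
    sum (map f xs) ≡ sum (map g xs)
  sum-cong []       f≗g = refl
  sum-cong (x ∷ xs) f≗g = cong₂ _+_ (f≗g x) (sum-cong xs f≗g)

  sum-mono : ∀ {A : Set} {f g : A → ℕ} (xs : List A) → (∀ x → f x ≤ g x) →
    sum (map f xs) ≤ sum (map g xs)
  sum-mono []       f≤g = z≤n
  sum-mono (x ∷ xs) f≤g = +-mono-≤ (f≤g x) (sum-mono xs f≤g)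

  sum-zero : ∀ {A : Set} (xs : List A) → sum (map (λ _ → 0) xs) ≡ 0
  sum-zero []       = refl
  sum-zero (x ∷ xs) = sum-zero xs

  sum-scale : ∀ {A : Set} (c : ℕ) (f : A → ℕ) (xs : List A) →
    sum (map (λ x → c * f x) xs) ≡ c * sum (map f xs)
  sum-scale c f []       = sym (*-zeroʳ c)
  sum-scale c f (x ∷ xs) rewrite sum-scale c f xs = sym (*-distribˡ-+ c (f x) _)

  sum-swap : ∀ {A B : Set} (f : A → B → ℕ) (xs : List A) (ys : List B) →
    sum (map (λ x → sum (map (f x) ys)) xs) ≡ sum (map (λ y → sum (map (λ x → f x y) xs)) ys)
  sum-swap f []       ys = sym (sum-zero ys)
  sum-swap f (x ∷ xs) ys rewrite sum-swap f xs ys =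
    sym (sum-+ (f x) (λ y → sum (map (λ x → f x y) xs)) ys)

open ListSums

module VolumesAndCuts where

  open import Data.Nat using (zero; suc; _+_; _*_; z≤n; s≤s)
  open import Data.Nat.Properties using (≤-trans; ≤-reflexive; +-identityʳ)
  open import Data.Bool using (Bool; true; false; not; _∧_)
  open import Data.Bool.ListAction using (any)
  open import Data.Fin using (zero; suc)
  open import Data.List using (List; []; _∷_; map; allFin)
  open import Data.List.Relation.Unary.Any using (Any; here; there)
  import Data.List.Relation.Unary.Any as Any
  open import Data.List.Relation.Unary.Any.Properties using (concatMap⁺)
  open import Data.Nat.ListAction using (sum)
  import Data.Rational as Q
  open import Relation.Binary.PropositionalEquality using (refl; sym; trans; cong; cong₂; _≗_)

  vol-split : ∀ {n} (G : Graph n) (S : VSubset n) → vol G S + vol G (compl S) ≡ volG G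
  vol-split {n} G S = trans (sym (sum-+ _ _ (allFin n))) (sum-cong (allFin n) split)
    where
    split : ∀ v → b2n (S v) * deg G v + b2n (not (S v)) * deg G v ≡ 1 * deg G v
    split v with S v
    ... | true  = +-identityʳ _
    ... | false = refl

  private
    b2n≤1 : ∀ b → b2n b ≤ 1
    b2n≤1 true  = s≤s z≤n
    b2n≤1 false = z≤n

    -- an edge uw leaving S is counted at most once among the edges at u ∈ S …
    edge≤tail : ∀ e s t → b2n (e ∧ s ∧ t) ≤ b2n s * b2n e
    edge≤tail true  true  t = ≤-trans (b2n≤1 t) (s≤s z≤n)
    edge≤tail true  false t = z≤n
    edge≤tail false s     t = z≤n

    -- … and at most once among the edges at w ∉ S
    edge≤head : ∀ e s t → b2n (e ∧ s ∧ t) ≤ b2n t * b2n e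
    edge≤head true  true  true  = s≤s z≤n
    edge≤head true  true  false = z≤n
    edge≤head true  false t     = z≤n
    edge≤head false s     t     = z≤n

  -- Every cut edge has an end on each side, so the cut is bounded by both volumes.
  cut≤vol : ∀ {n} (G : Graph n) (S : VSubset n) → cutC G S ≤ vol G S
  cut≤vol {n} G S = sum-mono (allFin n) edges-at-tail
    where
    edges-at-tail : ∀ u → sum (map (λ w → b2n (adj G u w ∧ S u ∧ not (S w))) (allFin n))
                          ≤ b2n (S u) * deg G u
    edges-at-tail u =
      ≤-trans (sum-mono (allFin n) (λ w → edge≤tail (adj G u w) (S u) (not (S w))))
              (≤-reflexive (sum-scale (b2n (S u)) (λ w → b2n (adj G u w)) (allFin n)))

  cut≤vol-compl : ∀ {n} (G : Graph n) (S : VSubset n) → cutC G S ≤ vol G (compl S)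
  cut≤vol-compl {n} G S =
    ≤-trans (≤-reflexive (sum-swap (λ u w → b2n (adj G u w ∧ S u ∧ not (S w))) (allFin n) (allFin n)))
            (sum-mono (allFin n) edges-at-head)
    where
    -- the cut edges entering w are among the edges at w (by symmetry of adj),
    -- and there are none unless w ∉ S
    edges-at-head : ∀ w → sum (map (λ u → b2n (adj G u w ∧ S u ∧ not (S w))) (allFin n))
                          ≤ b2n (not (S w)) * deg G w
    edges-at-head w =
      ≤-trans (sum-mono (allFin n) (λ u →
                 ≤-trans (edge≤head (adj G u w) (S u) (not (S w)))
                         (≤-reflexive (cong (λ b → b2n (not (S w)) * b2n b) (symm G u w)))))
              (≤-reflexive (sum-scale (b2n (not (S w))) (λ u → b2n (adj G w u)) (allFin n)))

  sum-absent : ∀ {A : Set} (S : A → Bool) (f : A → ℕ) (xs : List A) → any S xs ≡ false →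
    sum (map (λ v → b2n (S v) * f v) xs) ≡ 0
  sum-absent S f []       _ = refl
  sum-absent S f (x ∷ xs) none with S x
  sum-absent S f (x ∷ xs) ()   | true
  sum-absent S f (x ∷ xs) none | false = sum-absent S f xs none

  -- A set with a nonzero cut is nonempty and proper, since both of its volumes are nonzero.
  cut-positive⇒nonemptyProper : ∀ {n} (G : Graph n) (C : VSubset n) → 1 ≤ cutC G C →
    nonemptyProper C ≡ true
  cut-positive⇒nonemptyProper {n} G C 1≤cut
    with any C (allFin n) in noneIn | any (λ v → not (C v)) (allFin n) in noneOut
  ... | false | _ with () ← ≤-trans 1≤cut (≤-trans (cut≤vol G C)
                                (≤-reflexive (sum-absent C (deg G) (allFin n) noneIn)))
  ... | true | false with () ← ≤-trans 1≤cut (≤-trans (cut≤vol-compl G C)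
                                (≤-reflexive (sum-absent (compl C) (deg G) (allFin n) noneOut)))
  ... | true | true = refl

  cut-cong : ∀ {n} (G : Graph n) {S T : VSubset n} → S ≗ T → cutC G S ≡ cutC G T
  cut-cong {n} G S≗T = sum-cong (allFin n) λ u → sum-cong (allFin n) λ w →
    cong₂ (λ a b → b2n (adj G u w ∧ a ∧ not b)) (S≗T u) (S≗T w)

  vol-cong : ∀ {n} (G : Graph n) {S T : VSubset n} → S ≗ T → vol G S ≡ vol G T
  vol-cong {n} G S≗T = sum-cong (allFin n) λ u → cong (λ a → b2n a * deg G u) (S≗T u)

  Ncut-cong : ∀ {n} (G : Graph n) {S T : VSubset n} → S ≗ T → Ncut G S ≡ Ncut G T
  Ncut-cong G S≗T = cong₂ (λ c v → ℕ→ℚ c Q.* v) (cut-cong G S≗T)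
    (cong₂ (λ a b → inv a Q.+ inv b) (vol-cong G S≗T) (vol-cong G (λ v → cong not (S≗T v))))

  allSubsets-complete : ∀ n (S : VSubset n) → Any (_≗ S) (allSubsets n)
  allSubsets-complete zero    S = here (λ ())
  allSubsets-complete (suc n) S =
    concatMap⁺ _ (Any.map extend (allSubsets-complete n (λ i → S (suc i))))
    where
    extend : ∀ {T} → T ≗ (λ i → S (suc i)) → Any (_≗ S) (consS false T ∷ consS true T ∷ [])
    extend T≗S with S zero in S₀
    ... | false = here λ { zero → sym S₀ ; (suc v) → T≗S v }
    ... | true  = there (here λ { zero → sym S₀ ; (suc v) → T≗S v })

open VolumesAndCuts

module Minima where

  open import Data.Nat using (suc; _<_; _≡ᵇ_)
  open import Data.Nat.Properties using (≡ᵇ⇒≡; ≡⇒≡ᵇ)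
  open import Data.Bool using (T; T?; _∧_)
  open import Data.Bool.Properties using (T-∧; T-≡)
  open import Data.Maybe using (just; nothing)
  open import Data.Unit using (⊤; tt)
  open import Data.Empty using (⊥; ⊥-elim)
  open import Data.Product using (_,_; proj₂)
  open import Data.Sum using ([_,_]′)
  open import Data.List using (List; []; _∷_; map; foldr; filterᵇ; upTo)
  open import Data.List.Relation.Unary.All using (All; []; _∷_; universal)
  import Data.List.Relation.Unary.All as All
  open import Data.List.Relation.Unary.All.Properties using (all-filter; map⁺)
  open import Data.List.Relation.Unary.Any using (Any; here; there)
  import Data.List.Relation.Unary.Any as Any
  import Data.List.Relation.Unary.Any.Properties as AnyP
  open import Data.List.Membership.Propositional using (_∈_)
  open import Data.List.Membership.Propositional.Properties using (∈-map⁺; ∈-upTo⁺)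
  import Data.Rational as Q
  import Data.Rational.Properties as QP
  open import Function using (Equivalence; id)
  open import Relation.Binary.PropositionalEquality using (refl; sym; trans; cong; subst; _≗_)

  _≤∞_ : ℚ∞ → ℚ∞ → Set
  x       ≤∞ nothing = ⊤
  nothing ≤∞ just y  = ⊥
  just x  ≤∞ just y  = x Q.≤ y

  ≤∞-refl : ∀ x → x ≤∞ x
  ≤∞-refl nothing  = tt
  ≤∞-refl (just x) = QP.≤-refl

  ≤∞-trans : ∀ {x y z} → x ≤∞ y → y ≤∞ z → x ≤∞ z
  ≤∞-trans {z = nothing}               _   _   = tt
  ≤∞-trans {just x} {just y} {just z} x≤y y≤z = QP.≤-trans x≤y y≤z

  ≤∞-antisym : ∀ {x y} → x ≤∞ y → y ≤∞ x → x ≡ y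
  ≤∞-antisym {nothing} {nothing} _   _   = refl
  ≤∞-antisym {just x}  {just y}  x≤y y≤x = cong just (QP.≤-antisym x≤y y≤x)

  min∞-≤ˡ : ∀ x y → min∞ x y ≤∞ x
  min∞-≤ˡ nothing  y        = tt
  min∞-≤ˡ (just x) nothing  = QP.≤-refl
  min∞-≤ˡ (just x) (just y) = QP.p⊓q≤p x y

  min∞-≤ʳ : ∀ x y → min∞ x y ≤∞ y
  min∞-≤ʳ x        nothing  = tt
  min∞-≤ʳ nothing  (just y) = QP.≤-refl
  min∞-≤ʳ (just x) (just y) = QP.p⊓q≤q x y

  min∞-greatest : ∀ {m} x y → m ≤∞ x → m ≤∞ y → m ≤∞ min∞ x y
  min∞-greatest              nothing  y        _   m≤y = m≤y
  min∞-greatest              (just x) nothing  m≤x _   = m≤x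
  min∞-greatest {m = just m} (just x) (just y) m≤x m≤y = QP.⊓-glb m≤x m≤y

  minimum∞ : List ℚ∞ → ℚ∞
  minimum∞ = foldr min∞ nothing

  minimum∞-greatest : ∀ {m xs} → All (m ≤∞_) xs → m ≤∞ minimum∞ xs
  minimum∞-greatest []           = tt
  minimum∞-greatest (m≤x ∷ m≤xs) = min∞-greatest _ _ m≤x (minimum∞-greatest m≤xs)

  minimum∞-≤ : ∀ {x xs} → x ∈ xs → minimum∞ xs ≤∞ x
  minimum∞-≤ (here refl)   = min∞-≤ˡ _ _
  minimum∞-≤ (there x∈xs) = ≤∞-trans (min∞-≤ʳ _ _) (minimum∞-≤ x∈xs)

  minimum∞-attained : ∀ {x xs} → x ∈ xs → All (x ≤∞_) xs → minimum∞ xs ≡ x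
  minimum∞-attained x∈xs x≤xs = ≤∞-antisym (minimum∞-≤ x∈xs) (minimum∞-greatest x≤xs)

  module _ {n} (G : Graph n) where

    onLevel : ℕ → VSubset n → Set
    onLevel j C = T (nonemptyProper C ∧ (cutC G C ≡ᵇ j))

    McutJ-greatest : ∀ {j q} → (∀ C → cutC G C ≡ j → q Q.≤ Ncut G C) → just q ≤∞ McutJ j G
    McutJ-greatest {j} {q} bound =
      minimum∞-greatest (map⁺ (All.map level⇒bound (all-filter (λ C → T? _) (allSubsets n))))
      where
      level⇒bound : ∀ {C} → onLevel j C → just q ≤∞ just (Ncut G C)
      level⇒bound {C} onj = bound C (≡ᵇ⇒≡ _ j (proj₂ (Equivalence.to T-∧ onj)))

    McutJ-≤ : ∀ {j} (A : VSubset n) → cutC G A ≡ j → 1 ≤ j → McutJ j G ≤∞ just (Ncut G A)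
    McutJ-≤ {j} A cutA 1≤j = minimum∞-≤ (AnyP.map⁺ (Any.map sameNcut inFilter))
      where
      onLevel-cong : ∀ {T} → T ≗ A → onLevel j T
      onLevel-cong {T} T≗A = Equivalence.from T-∧
        ( Equivalence.from T-≡ (cut-positive⇒nonemptyProper G T (subst (1 ≤_) (sym cutT) 1≤j))
        , ≡⇒≡ᵇ _ _ cutT)
        where
        cutT : cutC G T ≡ j
        cutT = trans (cut-cong G T≗A) cutA
      inFilter : Any (_≗ A) (filterᵇ (λ C → nonemptyProper C ∧ (cutC G C ≡ᵇ j)) (allSubsets n))
      inFilter = [ id , (λ notOn → ⊥-elim (notOn (onLevel-cong (AnyP.lookup-result found)))) ]′
                   (AnyP.filter⁺ (λ C → T? _) found)
        where found = allSubsets-complete n A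
      sameNcut : ∀ {T} → T ≗ A → just (Ncut G A) ≡ just (Ncut G T)
      sameNcut T≗A = cong just (Ncut-cong G (λ v → sym (T≗A v)))

    Mcut-attained : ∀ {i} → i < volG G → (∀ j → McutJ (suc i) G ≤∞ McutJ (suc j) G) →
      Mcut G ≡ McutJ (suc i) G
    Mcut-attained i<V lowest =
      minimum∞-attained (∈-map⁺ (λ j → McutJ (suc j) G) (∈-upTo⁺ i<V)) (map⁺ (universal lowest _))

open Minima

-- Here X and Y stand for the volume
-- products c c' and a a', s and t for the squared deviations, and W for V², so that the
-- hypotheses  4X + s = W  and  4Y + t = W  are the product identity for C and A.
module ProductBounds where

  open import Data.Nat using (_+_; _*_; _<_)
  open import Data.Nat.Properties
    using (≤-trans; <⇒≤; m≤m+n; +-monoʳ-≤; +-monoʳ-<; *-monoʳ-≤; *-monoˡ-≤; +-cancelʳ-<; +-cancelʳ-≤;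
           *-cancelˡ-≤; module ≤-Reasoning)
  open import Data.Nat.Tactic.RingSolver using (solve-∀)
  open import Relation.Binary.PropositionalEquality using (cong; sym)

  -- A cut with one edge: if 2s > 36 + W then 8X < W − 36 ≤ 4Y.
  one-edge-bound : ∀ X Y s t W → 4 * X + s ≡ W → 4 * Y + t ≡ W → t ≤ 36 → 36 + W < 2 * s →
    2 * X ≤ Y
  one-edge-bound X Y s t W idC idA t≤36 s-large =
    *-cancelˡ-≤ 4 (<⇒≤ (+-cancelʳ-< 36 (4 * (2 * X)) (4 * Y) (≤-trans below-W W≤)))
    where
    open ≤-Reasoning
    doubled : ∀ X s → 4 * (2 * X) + 2 * s ≡ 2 * (4 * X + s)
    doubled = solve-∀
    regroup : ∀ a b c → a + (b + c) ≡ (a + b) + c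
    regroup = solve-∀
    twice : ∀ W → 2 * W ≡ W + W
    twice = solve-∀
    below-W : 4 * (2 * X) + 36 < W
    below-W = +-cancelʳ-< W _ W (begin-strict
      (4 * (2 * X) + 36) + W  ≡⟨ sym (regroup (4 * (2 * X)) 36 W) ⟩
      4 * (2 * X) + (36 + W)  <⟨ +-monoʳ-< (4 * (2 * X)) s-large ⟩
      4 * (2 * X) + 2 * s     ≡⟨ doubled X s ⟩
      2 * (4 * X + s)         ≡⟨ cong (2 *_) idC ⟩
      2 * W                   ≡⟨ twice W ⟩
      W + W                   ∎)
    W≤ : W ≤ 4 * Y + 36
    W≤ = begin
      W          ≡⟨ sym idA ⟩
      4 * Y + t  ≤⟨ +-monoʳ-≤ (4 * Y) t≤36 ⟩
      4 * Y + 36 ∎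

  -- A cut with j ≥ 3 edges: 8X ≤ 2W ≤ 3W − 108 ≤ 12Y, using W ≥ 121.
  many-edges-bound : ∀ X Y s t W j → 4 * X + s ≡ W → 4 * Y + t ≡ W → t ≤ 36 → 121 ≤ W → 3 ≤ j →
    2 * X ≤ j * Y
  many-edges-bound X Y s t W j idC idA t≤36 121≤W 3≤j =
    ≤-trans (*-cancelˡ-≤ 4 (≤-trans 8X≤2W (+-cancelʳ-≤ (3 * t) _ _ 2W≤3W))) (*-monoˡ-≤ Y 3≤j)
    where
    open ≤-Reasoning
    doubled : ∀ X s → 2 * (4 * X + s) ≡ 4 * (2 * X) + 2 * s
    doubled = solve-∀
    tripled : ∀ Y t → 3 * (4 * Y + t) ≡ 4 * (3 * Y) + 3 * t
    tripled = solve-∀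
    thrice : ∀ W → 2 * W + W ≡ 3 * W
    thrice = solve-∀
    8X≤2W : 4 * (2 * X) ≤ 2 * W
    8X≤2W = begin
      4 * (2 * X)           ≤⟨ m≤m+n _ _ ⟩
      4 * (2 * X) + 2 * s   ≡⟨ sym (doubled X s) ⟩
      2 * (4 * X + s)       ≡⟨ cong (2 *_) idC ⟩
      2 * W                 ∎
    2W≤3W : 2 * W + 3 * t ≤ 4 * (3 * Y) + 3 * t
    2W≤3W = begin
      2 * W + 3 * t         ≤⟨ +-monoʳ-≤ (2 * W) (*-monoʳ-≤ 3 t≤36) ⟩
      2 * W + 108           ≤⟨ +-monoʳ-≤ (2 * W) (≤-trans (m≤m+n 108 13) 121≤W) ⟩
      2 * W + W             ≡⟨ thrice W ⟩
      3 * W                 ≡⟨ cong (3 *_) (sym idA) ⟩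
      3 * (4 * Y + t)       ≡⟨ tripled Y t ⟩
      4 * (3 * Y) + 3 * t   ∎

open ProductBounds

-- Translation of the rational quantities into natural numbers, via the unnormalised
-- rationals ℚᵘ, where sums and products of fractions are computed syntactically.
module RationalForms where

  open import Data.Nat using (suc; _+_; _*_; _<_; s≤s)
  open import Data.Nat.Properties using (*-monoʳ-≤; *-monoˡ-≤; *-identityʳ; ≰⇒>; module ≤-Reasoning)
  open import Data.Nat.Tactic.RingSolver using (solve-∀)
  open import Data.Integer as Z using (ℤ; -[1+_]; +≤+)
  import Data.Integer.Properties as ZP
  import Data.Integer.Tactic.RingSolver as ZSolver
  open import Data.Rational as Q using (ℚ; _/_)
  import Data.Rational.Properties as QP
  open import Data.Rational.Unnormalised as U using (ℚᵘ; mkℚᵘ; *≤*)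
  import Data.Rational.Unnormalised.Properties as UP
  open import Relation.Binary.PropositionalEquality using (refl; sym; trans; cong; cong₂; subst₂)

  -- frac p a is the fraction p / (1 + a).
  frac : ℕ → ℕ → ℚᵘ
  frac p a = mkℚᵘ (+ p) a

  -- the denominator of a product: 1 + predProd a b = (1 + a) (1 + b)
  predProd : ℕ → ℕ → ℕ
  predProd a b = b + a * suc b

  frac-+ : ∀ p a q b → frac p a U.+ frac q b ≡ frac (p * suc b + q * suc a) (predProd a b)
  frac-+ p a q b = cong (λ z → mkℚᵘ z (predProd a b))
    (trans (cong₂ Z._+_ (sym (ZP.pos-* p (suc b))) (sym (ZP.pos-* q (suc a))))
           (sym (ZP.pos-+ (p * suc b) (q * suc a))))

  frac-* : ∀ p a q b → frac p a U.* frac q b ≡ frac (p * q) (predProd a b)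
  frac-* p a q b = cong (λ z → mkℚᵘ z (predProd a b)) (sym (ZP.pos-* p q))

  frac-≤ : ∀ p a q b → p * suc b ≤ q * suc a → frac p a U.≤ frac q b
  frac-≤ p a q b h = *≤* (subst₂ Z._≤_ (ZP.pos-* p (suc b)) (ZP.pos-* q (suc a)) (+≤+ h))

  frac-≤⁻ : ∀ p a q b → frac p a U.≤ frac q b → p * suc b ≤ q * suc a
  frac-≤⁻ p a q b (*≤* h) with subst₂ Z._≤_ (sym (ZP.pos-* p (suc b))) (sym (ZP.pos-* q (suc a))) h
  ... | +≤+ h′ = h′

  toℚᵘ-ℕ→ℚ : ∀ k → Q.toℚᵘ (ℕ→ℚ k) U.≃ frac k 0
  toℚᵘ-ℕ→ℚ k = QP.toℚᵘ-fromℚᵘ (mkℚᵘ (+ k) 0)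

  toℚᵘ-inv : ∀ k → Q.toℚᵘ (inv (suc k)) U.≃ frac 1 k
  toℚᵘ-inv k = QP.toℚᵘ-fromℚᵘ (mkℚᵘ (+ 1) k)

  ncut-fraction : ∀ j c₀ d₀ → Q.toℚᵘ (ℕ→ℚ j Q.* (inv (suc c₀) Q.+ inv (suc d₀))) U.≃
    frac (j * (1 * suc d₀ + 1 * suc c₀)) (predProd 0 (predProd c₀ d₀))
  ncut-fraction j c₀ d₀ = UP.≃-trans (QP.toℚᵘ-homo-* (ℕ→ℚ j) _)
    (UP.≃-trans (UP.*-cong (toℚᵘ-ℕ→ℚ j) (UP.≃-trans (QP.toℚᵘ-homo-+ (inv (suc c₀)) (inv (suc d₀)))
                                                   (UP.+-cong (toℚᵘ-inv c₀) (toℚᵘ-inv d₀))))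
                (UP.≃-reflexive (trans (cong (frac j 0 U.*_) (frac-+ 1 c₀ 1 d₀)) (frac-* j 0 _ _))))

  -- Two normalised cuts over the same total volume compare like  k c c'  and  j a a':
  -- k (1/a + 1/a') = k (a + a') / (a a')  and  j (1/c + 1/c') = j (c + c') / (c c').
  ncut-≤ : ∀ k a a' j c c' → 1 ≤ a → 1 ≤ a' → 1 ≤ c → 1 ≤ c' → c + c' ≡ a + a' →
    k * (c * c') ≤ j * (a * a') →
    ℕ→ℚ k Q.* (inv a Q.+ inv a') Q.≤ ℕ→ℚ j Q.* (inv c Q.+ inv c')
  ncut-≤ k a@(suc a₀) a'@(suc a₀') j c@(suc c₀) c'@(suc c₀') (s≤s _) (s≤s _) (s≤s _) (s≤s _)
         sameTotal cross =
    QP.toℚᵘ-cancel-≤ (UP.≤-respˡ-≃ (UP.≃-sym (ncut-fraction k a₀ a₀'))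
                     (UP.≤-respʳ-≃ (UP.≃-sym (ncut-fraction j c₀ c₀')) (frac-≤ _ _ _ _ scaled)))
    where
    open ≤-Reasoning
    normalise : ∀ k a a' c c' → (k * (1 * a' + 1 * a)) * (1 * (c * c')) ≡ (a + a') * (k * (c * c'))
    normalise = solve-∀
    scaled : (k * (1 * a' + 1 * a)) * (1 * (c * c')) ≤ (j * (1 * c' + 1 * c)) * (1 * (a * a'))
    scaled = begin
      (k * (1 * a' + 1 * a)) * (1 * (c * c')) ≡⟨ normalise k a a' c c' ⟩
      (a + a') * (k * (c * c'))               ≤⟨ *-monoʳ-≤ (a + a') cross ⟩
      (a + a') * (j * (a * a'))               ≡⟨ cong (λ V → V * (j * (a * a'))) (sym sameTotal) ⟩
      (c + c') * (j * (a * a'))               ≡⟨ sym (normalise j c c' a a') ⟩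
      (j * (1 * c' + 1 * c)) * (1 * (a * a')) ∎

  centred : ℕ → ℕ → ℚ
  centred b V = ℕ→ℚ b Q.- ℕ→ℚ V Q.* (+ 1 / 2)

  -- 2b − V, written exactly as the numerator of centred b V over 2 arises in ℚᵘ
  twiceCentred : ℕ → ℕ → ℤ
  twiceCentred b V = (+ b Z.* + 2) Z.+ (Z.- (+ V Z.* + 1)) Z.* + 1

  deviation : ℕ → ℕ → ℕ
  deviation b V = Z.∣ twiceCentred b V ∣

  NearHalf : ℕ → ℕ → Set
  NearHalf b V = deviation b V ≤ 6

  FarFromHalf : ℕ → ℕ → Set
  FarFromHalf b V = 36 + V * V < 2 * (deviation b V * deviation b V)

  centred-ℚᵘ : ∀ b V → Q.toℚᵘ (centred b V) U.≃ mkℚᵘ (twiceCentred b V) 1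
  centred-ℚᵘ b V = UP.≃-trans (QP.toℚᵘ-homo-+ (ℕ→ℚ b) _)
    (UP.+-cong (toℚᵘ-ℕ→ℚ b)
               (UP.≃-trans (QP.toℚᵘ-homo‿- (ℕ→ℚ V Q.* (+ 1 / 2)))
                           (UP.-‿cong (UP.≃-trans (QP.toℚᵘ-homo-* (ℕ→ℚ V) (+ 1 / 2))
                                                  (UP.*-cong (toℚᵘ-ℕ→ℚ V) UP.≃-refl)))))

  square-abs : ∀ z → z Z.* z ≡ + (Z.∣ z ∣ * Z.∣ z ∣)
  square-abs (+ n)    = sym (ZP.pos-* n n)
  square-abs -[1+ n ] = refl

  square-identity : ∀ b b' →
    4 * (b * b') + deviation b (b + b') * deviation b (b + b') ≡ (b + b') * (b + b')
  square-identity b b' = ZP.+-injective (begin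
    + (4 * (b * b') + d * d)                    ≡⟨ ZP.pos-+ (4 * (b * b')) (d * d) ⟩
    + (4 * (b * b')) Z.+ + (d * d)              ≡⟨ cong₂ Z._+_ product (sym (square-abs (twiceCentred b (b + b')))) ⟩
    quadratic (+ (b + b'))                      ≡⟨ cong quadratic (ZP.pos-+ b b') ⟩
    quadratic (+ b Z.+ + b')                    ≡⟨ identityℤ (+ b) (+ b') ⟩
    (+ b Z.+ + b') Z.* (+ b Z.+ + b')           ≡⟨ cong (λ w → w Z.* w) (sym (ZP.pos-+ b b')) ⟩
    + (b + b') Z.* + (b + b')                   ≡⟨ sym (ZP.pos-* (b + b') (b + b')) ⟩
    + ((b + b') * (b + b'))                     ∎)
    where
    open Relation.Binary.PropositionalEquality.≡-Reasoning
    d = deviation b (b + b')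
    centredℤ : ℤ → ℤ → ℤ
    centredℤ B W = (B Z.* + 2) Z.+ (Z.- (W Z.* + 1)) Z.* + 1
    quadratic : ℤ → ℤ
    quadratic W = + 4 Z.* (+ b Z.* + b') Z.+ centredℤ (+ b) W Z.* centredℤ (+ b) W
    identityℤ : ∀ B B' →
      + 4 Z.* (B Z.* B') Z.+ ((B Z.* + 2) Z.+ (Z.- ((B Z.+ B') Z.* + 1)) Z.* + 1)
                           Z.* ((B Z.* + 2) Z.+ (Z.- ((B Z.+ B') Z.* + 1)) Z.* + 1)
        ≡ (B Z.+ B') Z.* (B Z.+ B')
    identityℤ = ZSolver.solve-∀
    product : + (4 * (b * b')) ≡ + 4 Z.* (+ b Z.* + b')
    product = trans (ZP.pos-* 4 (b * b')) (cong (+ 4 Z.*_) (ZP.pos-* b b'))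

  deviation-bound : ∀ b V → Q.∣ centred b V ∣ Q.≤ ℕ→ℚ 3 → NearHalf b V
  deviation-bound b V near = subst₂ _≤_ (*-identityʳ _) refl
    (frac-≤⁻ (deviation b V) 1 3 0
      (UP.≤-respˡ-≃ (UP.≃-trans (QP.toℚᵘ-homo-∣-∣ (centred b V)) (UP.∣-∣-cong (centred-ℚᵘ b V)))
        (UP.≤-respʳ-≃ (toℚᵘ-ℕ→ℚ 3) (QP.toℚᵘ-mono-≤ near))))

  deviation-large : ∀ b V →
    ¬ (centred b V Q.* centred b V Q.≤ (ℕ→ℚ 36 Q.+ ℕ→ℚ V Q.* ℕ→ℚ V) Q.* (+ 1 / 8)) →
    FarFromHalf b V
  deviation-large b V far = ≰⇒> λ small →
    far (QP.toℚᵘ-cancel-≤ (UP.≤-respˡ-≃ (UP.≃-sym square-ℚᵘ) (UP.≤-respʳ-≃ (UP.≃-sym bound-ℚᵘ)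
          (frac-≤ _ 3 _ 7 (subst₂ _≤_ (left d) (right V) (*-monoˡ-≤ 4 small))))))
    where
    d = deviation b V
    left : ∀ d → 2 * (d * d) * 4 ≡ d * d * 8
    left = solve-∀
    right : ∀ V → (36 + V * V) * 4 ≡ ((36 * 1 + V * V * 1) * 1) * 4
    right = solve-∀
    square-ℚᵘ : Q.toℚᵘ (centred b V Q.* centred b V) U.≃ frac (d * d) 3
    square-ℚᵘ = UP.≃-trans (QP.toℚᵘ-homo-* (centred b V) (centred b V))
      (UP.≃-trans (UP.*-cong (centred-ℚᵘ b V) (centred-ℚᵘ b V))
                  (UP.≃-reflexive (cong (λ z → mkℚᵘ z 3) (square-abs (twiceCentred b V)))))
    numerator-ℚᵘ : Q.toℚᵘ (ℕ→ℚ 36 Q.+ ℕ→ℚ V Q.* ℕ→ℚ V) U.≃ frac 36 0 U.+ frac V 0 U.* frac V 0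
    numerator-ℚᵘ = UP.≃-trans (QP.toℚᵘ-homo-+ (ℕ→ℚ 36) (ℕ→ℚ V Q.* ℕ→ℚ V))
      (UP.+-cong (toℚᵘ-ℕ→ℚ 36) (UP.≃-trans (QP.toℚᵘ-homo-* (ℕ→ℚ V) (ℕ→ℚ V))
                                           (UP.*-cong (toℚᵘ-ℕ→ℚ V) (toℚᵘ-ℕ→ℚ V))))
    computed : (frac 36 0 U.+ frac V 0 U.* frac V 0) U.* frac 1 7 ≡ frac ((36 * 1 + V * V * 1) * 1) 7
    computed = trans (cong (λ x → (frac 36 0 U.+ x) U.* frac 1 7) (frac-* V 0 V 0))
                     (trans (cong (U._* frac 1 7) (frac-+ 36 0 (V * V) 0)) (frac-* (36 * 1 + V * V * 1) 0 1 7))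
    bound-ℚᵘ : Q.toℚᵘ ((ℕ→ℚ 36 Q.+ ℕ→ℚ V Q.* ℕ→ℚ V) Q.* (+ 1 / 8)) U.≃ frac ((36 * 1 + V * V * 1) * 1) 7
    bound-ℚᵘ = UP.≃-trans (QP.toℚᵘ-homo-* (ℕ→ℚ 36 Q.+ ℕ→ℚ V Q.* ℕ→ℚ V) (+ 1 / 8))
                          (UP.≃-trans (UP.*-cong numerator-ℚᵘ UP.≃-refl) (UP.≃-reflexive computed))

open RationalForms

module BalancedTwoEdgeCut {n} (G : Graph n) (A : VSubset n)
    (large : 11 ≤ volG G)
    (cut-A : cutC G A ≡ 2)
    (balanced-A : NearHalf (vol G A) (volG G))
    (unbalanced-one-edge : ∀ B → cutC G B ≡ 1 → FarFromHalf (vol G B) (volG G))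
  where

  open import Data.Nat using (zero; suc; _+_; _*_; z≤n; s≤s)
  open import Data.Nat.Properties using (≤-trans; *-mono-≤; *-identityˡ)
  open import Data.Product using (_,_; proj₁; proj₂)
  open import Data.Empty using (⊥-elim)
  import Data.Rational as Q
  open import Relation.Binary.PropositionalEquality using (refl; sym; trans; subst; subst₂; _≢_)

  dev : VSubset n → ℕ
  dev S = deviation (vol G S) (volG G)

  volProduct : VSubset n → ℕ
  volProduct S = vol G S * vol G (compl S)

  product-identity : ∀ S → 4 * volProduct S + dev S * dev S ≡ volG G * volG G
  product-identity S = subst (λ V → 4 * (s * s') + deviation s V * deviation s V ≡ V * V)
                             (vol-split G S) (square-identity s s')
    where
    s  = vol G S
    s' = vol G (compl S)

  positive-volumes : ∀ C → 1 ≤ cutC G C → 1 ≤ vol G C × 1 ≤ vol G (compl C)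
  positive-volumes C 1≤cut = ≤-trans 1≤cut (cut≤vol G C) , ≤-trans 1≤cut (cut≤vol-compl G C)

  A-square≤36 : dev A * dev A ≤ 36
  A-square≤36 = *-mono-≤ balanced-A balanced-A

  -- Ncut(A) ≤ Ncut(C) in cross-multiplied form:  2 c c' ≤ j a a'  for a cut of size j ∉ {0, 2}.
  cross-products : ∀ C j → cutC G C ≡ j → 1 ≤ j → j ≢ 2 → 2 * volProduct C ≤ j * volProduct A
  cross-products C zero _ () _
  cross-products C 1 cut-C _ _ = subst (2 * volProduct C ≤_) (sym (*-identityˡ (volProduct A)))
    (one-edge-bound (volProduct C) (volProduct A) (dev C * dev C) (dev A * dev A) (volG G * volG G)
                    (product-identity C) (product-identity A) A-square≤36 (unbalanced-one-edge C cut-C))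
  cross-products C 2 _ _ ≢2 = ⊥-elim (≢2 refl)
  cross-products C j@(suc (suc (suc _))) _ _ _ =
    many-edges-bound (volProduct C) (volProduct A) (dev C * dev C) (dev A * dev A) (volG G * volG G) j
                     (product-identity C) (product-identity A) A-square≤36 (*-mono-≤ large large)
                     (s≤s (s≤s (s≤s z≤n)))

  Ncut-A≤ : ∀ C j → cutC G C ≡ j → 1 ≤ j → j ≢ 2 → Ncut G A Q.≤ Ncut G C
  Ncut-A≤ C j cut-C 1≤j j≢2 =
    subst₂ (λ k m → ℕ→ℚ k Q.* (inv a Q.+ inv a') Q.≤ ℕ→ℚ m Q.* (inv c Q.+ inv c'))
           (sym cut-A) (sym cut-C)
      (ncut-≤ 2 a a' j c c' (proj₁ vols-A) (proj₂ vols-A) (proj₁ vols-C) (proj₂ vols-C)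
              (trans (vol-split G C) (sym (vol-split G A))) (cross-products C j cut-C 1≤j j≢2))
    where
    a  = vol G A
    a' = vol G (compl A)
    c  = vol G C
    c' = vol G (compl C)
    vols-A = positive-volumes A (subst (1 ≤_) (sym cut-A) (s≤s z≤n))
    vols-C = positive-volumes C (subst (1 ≤_) (sym cut-C) 1≤j)

  -- every level other than 2 lies above Ncut(A), which lies above level 2
  via-A : ∀ {j} → suc j ≢ 2 → McutJ 2 G ≤∞ McutJ (suc j) G
  via-A {j} j≢2 = ≤∞-trans (McutJ-≤ G A cut-A (s≤s z≤n))
    (McutJ-greatest G (λ C cut-C → Ncut-A≤ C (suc j) cut-C (s≤s z≤n) j≢2))

  level-2-lowest : ∀ j → McutJ 2 G ≤∞ McutJ (suc j) G
  level-2-lowest zero          = via-A (λ ())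
  level-2-lowest (suc zero)    = ≤∞-refl _
  level-2-lowest (suc (suc j)) = via-A (λ ())

  Mcut≡McutJ2 : Mcut G ≡ McutJ 2 G
  Mcut≡McutJ2 = Mcut-attained G (≤-trans (s≤s (s≤s z≤n)) large) level-2-lowest

open import Data.Rational using (ℚ; _/_; ∣_∣; _-_; _*_; _+_)
open import Data.Rational renaming (_≤_ to _≤ℚ_)
open import Data.Product using (_,_)

lemma12 : ∀ {n : ℕ} (G : Graph n) → Connected G → 11 ≤ volG G →
    Σ (VSubset n) (λ A → cutC G A ≡ 2 ×
      ∣ ℕ→ℚ (vol G A) - ℕ→ℚ (volG G) * (+ 1 / 2) ∣ ≤ℚ ℕ→ℚ 3) →
    (∀ (B : VSubset n) → cutC G B ≡ 1 →
      ¬ ((ℕ→ℚ (vol G B) - ℕ→ℚ (volG G) * (+ 1 / 2)) * (ℕ→ℚ (vol G B) - ℕ→ℚ (volG G) * (+ 1 / 2))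
          ≤ℚ (ℕ→ℚ 36 + ℕ→ℚ (volG G) * ℕ→ℚ (volG G)) * (+ 1 / 8))) →
    Mcut G ≡ McutJ 2 G
lemma12 G _ large (A , cut-A , A-near) one-edge-far =
  BalancedTwoEdgeCut.Mcut≡McutJ2 G A large cut-A
    (deviation-bound (vol G A) (volG G) A-near)
    (λ B cut-B → deviation-large (vol G B) (volG G) (one-edge-far B cut-B))
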